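{- Let $\pi$ be a play in $G'$ from $(s_{\mathrm{init}},0)$ with $\overline{\mathrm{MP}}(\pi)\le t$. Then there exists $n\in\mathbb N$ such that for every $n'\ge n$, \[\mathrm{density}(\Gamma^{\le t},\pi_{\le n'})\ge\frac{\tilde t}{2(t+1)}.\]
   Context: $G=(S_0,S_1,E)$ is a finite weighted game ($S=S_0\cup S_1$ finite, $E\subseteq S\times\mathbb Z\times S$ finite, every state with an outgoing edge), $s_{\mathrm{init}}\in S$, and $t=t_1/t_2$ with $t_1,t_2\in\mathbb N$, $t_2\ge1$; $\tilde t=\lfloor t\rfloor+1-t$. The expanded game $G'$ has configurations $(S\times\mathbb N)\uplus\{\bot\}$ and edges: $((s,c),c',(s',c'))$ whenever $(s,w,s')\in E$ and $c'=c+w\ge0$; $((s,c),\lceil t\rceil+1,\bot)$ whenever some $(s,w,s')\in E$ has $c+w<0$; and $(\bot,\lceil t\rceil+1,\bot)$. A play is an infinite sequence of edges $e_1e_2\cdots$ with $\mathrm{tgt}(e_i)=\mathrm{src}(e_{i+1})$; $\overline{\mathrm{MP}}(\pi)=\limsup_n\frac1n\sum_{i=1}^n w(e_i)$. For a prefix $\rho=e_1\cdots e_m$, let $\hat\rho_0=\mathrm{src}(e_1)$ and $\hat\rho_i=\mathrm{tgt}(e_i)$; for a set $\tilde\Gamma$ of configurations, $\mathrm{density}(\tilde\Gamma,\rho)=|\{1\le i\le m\mid\hat\rho_i\in\tilde\Gamma\}|/m$. $\pi_{\le n}=e_1\cdots e_n$ and $\Gamma^{\le t}=\{(s,c)\in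 S\times\mathbb N\mid c\le t\}$. -}

module Defs where

open import Data.Nat as ℕ using (ℕ; zero; suc)
open import Data.Integer as ℤ using (ℤ; +_)
open import Data.Rational as ℚ using (ℚ; _/_; 1ℚ; Positive; NonNegative; NonZero)
open import Data.Rational.Properties as ℚP using ()
open import Data.Fin using (Fin)
open import Data.Bool using (Bool; if_then_else_)
open import Data.List using (List)
open import Data.List.Membership.Propositional using (_∈_)
open import Data.Product using (_×_; _,_; ∃; ∃-syntax)
open import Data.Empty using (⊥)
open import Relation.Nullary using (Dec; yes; no; does)
open import Relation.Binary.PropositionalEquality using (_≡_)

-- States are Fin size; owner s = true means s ∈ S₀, false means s ∈ S₁
-- (so S = S₀ ⊎ S₁ is a partition).

record Game : Set where
  field
    size     : ℕ
    owner    : Fin size → Bool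
    edges    : List (Fin size × ℤ × Fin size)
    total    : ∀ s → ∃[ w ] ∃[ s' ] ((s , w , s') ∈ edges)

open Game public

threshold : (t₁ t₂ : ℕ) → .{{ℕ.NonZero t₂}} → ℚ
threshold t₁ t₂ = + t₁ / t₂

-- ⌈t⌉ + 1 (an integer), the weight of edges into ⊥
ceil+1 : ℚ → ℤ
ceil+1 t = ℚ.ceiling t ℤ.+ + 1

tTilde : ℚ → ℚ
tTilde t = ((ℚ.floor t ℤ.+ + 1) / 1) ℚ.- t

data Conf (G : Game) : Set where
  cfg : Fin (size G) → ℕ → Conf G
  bot : Conf G

data Edge' (G : Game) (t : ℚ) : Conf G → ℤ → Conf G → Set where
  step : ∀ {s w s' c c'} → (s , w , s') ∈ edges G →
         (+ c) ℤ.+ w ≡ + c' →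
         Edge' G t (cfg s c) (+ c') (cfg s' c')
  fall : ∀ {s w s' c} → (s , w , s') ∈ edges G →
         (+ c) ℤ.+ w ℤ.< + 0 →
         Edge' G t (cfg s c) (ceil+1 t) bot
  loop : Edge' G t bot (ceil+1 t) bot

-- A play e₁e₂⋯ is represented by the sequence of
-- configurations it visits, conf 0 = src(e₁), conf i = tgt(eᵢ) = ρ̂ᵢ,
-- together with the weights, wt i = w(e_{i+1}); consecutive edges chain
-- automatically, and each e_{i+1} = (conf i, wt i, conf (i+1)) is an edge of G'.

record Play (G : Game) (t : ℚ) : Set where
  field
    conf  : ℕ → Conf G
    wt    : ℕ → ℤ
    valid : ∀ i → Edge' G t (conf i) (wt i) (conf (suc i))

open Play public

weightSum : ∀ {G t} → Play G t → ℕ → ℤ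
weightSum π zero    = + 0
weightSum π (suc n) = weightSum π n ℤ.+ wt π n

average : ∀ {G t} → Play G t → (n : ℕ) → .{{ℕ.NonZero n}} → ℚ
average π n = weightSum π n / n

-- limsup_n (1/n) Σ_{i≤n} w(eᵢ) ≤ t, unfolded: for every ε > 0 the
-- averages are eventually ≤ t + ε.
MPsup≤ : ∀ {G t} → Play G t → ℚ → Set
MPsup≤ π r = ∀ (ε : ℚ) → .{{Positive ε}} →
  ∃[ N ] ∀ (n : ℕ) → .{{_ : ℕ.NonZero n}} → N ℕ.≤ n → average π n ℚ.≤ r ℚ.+ ε

InΓ≤ : ∀ {G} → ℚ → Conf G → Set
InΓ≤ t (cfg s c) = (+ c / 1) ℚ.≤ t
InΓ≤ t bot       = ⊥

inΓ≤? : ∀ {G} (t : ℚ) (x : Conf G) → Dec (InΓ≤ t x)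
inΓ≤? t (cfg s c) = (+ c / 1) ℚP.≤? t
inΓ≤? t bot       = no (λ ())

-- |{1 ≤ i ≤ m | ρ̂ᵢ ∈ Γ^{≤t}}| for the prefix π_{≤m}
countΓ≤ : ∀ {G t} → ℚ → Play G t → ℕ → ℕ
countΓ≤ r π zero    = 0
countΓ≤ r π (suc m) = countΓ≤ r π m ℕ.+ (if does (inΓ≤? r (conf π (suc m))) then 1 else 0)

densityΓ≤ : ∀ {G t} → ℚ → Play G t → (m : ℕ) → .{{ℕ.NonZero m}} → ℚ
densityΓ≤ r π m = + countΓ≤ r π m / m

twoTPlus1 : ℚ → ℚ
twoTPlus1 t = (+ 2 / 1) ℚ.* (t ℚ.+ 1ℚ)

twoTPlus1-nonZero : ∀ t → .{{NonNegative t}} → NonZero (twoTPlus1 t)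
twoTPlus1-nonZero t = ℚP.pos⇒nonZero (twoTPlus1 t)
  {{ℚP.pos*pos⇒pos (+ 2 / 1) {{_}} (t ℚ.+ 1ℚ) {{ℚP.nonNeg+pos⇒pos t 1ℚ {{_}}}}}}

densityBound : (t₁ t₂ : ℕ) → .{{_ : ℕ.NonZero t₂}} → ℚ
densityBound t₁ t₂ = ℚ._÷_ (tTilde t) (twoTPlus1 t)
    {{twoTPlus1-nonZero t {{ℚP.normalize-nonNeg t₁ t₂}}}}
  where t = threshold t₁ t₂

module Submission where

-- Put D = ⌊t⌋ + 1 = t + t̃. An edge of G' entering a configuration outside
-- Γ^{≤t} has weight at least D (its weight is the new counter value c' > t,
-- or ⌈t⌉ + 1 when it enters ⊥), and every edge entering Γ^{≤t} has weight
-- at least 0. So a prefix of length n visiting Γ^{≤t} K times has total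
-- weight W with n D ≤ W + K D. Once the averages stay below t + t̃/2 we get
-- n t̃/2 ≤ K D ≤ K (t + 1), i.e. K/n ≥ t̃ / (2(t + 1)).

open import Defs
open import Data.Nat as ℕ using (ℕ; zero; suc)
open import Data.Integer as ℤ using (ℤ; +_)
import Data.Nat.Properties as ℕP
import Data.Integer.Properties as ℤP
import Data.Integer.DivMod as ℤD
open import Data.Integer.Tactic.RingSolver using (solve-∀)
open import Data.Rational as ℚ using (ℚ; mkℚ; _/_; _+_; _-_; _*_; -_; _≤_; _<_; 1ℚ; ½; floor; ceiling)
import Data.Rational.Properties as ℚP
import Data.Rational.Unnormalised as ℚᵘ
import Data.Rational.Unnormalised.Properties as ℚᵘP
open import Data.Rational.Solver using (module +-*-Solver)
open import Algebra.Properties.Group ℚP.+-0-group using () renaming (⁻¹-involutive to neg-involutive)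
open import Data.Bool using (if_then_else_)
open import Data.Fin using (Fin)
open import Data.Product using (∃-syntax; _,_)
open import Relation.Nullary using (¬_; yes; no; does)
open import Relation.Nullary.Decidable using (dec-true; dec-false)
open import Relation.Binary.PropositionalEquality

fromℤ : ℤ → ℚ
fromℤ i = i / 1

toℚᵘ-/ : ∀ i n → ℚ.toℚᵘ (i / suc n) ℚᵘ.≃ ℚᵘ.mkℚᵘ i n
toℚᵘ-/ i n = ℚP.toℚᵘ-fromℚᵘ (ℚᵘ.mkℚᵘ i n)

fromℤ-homo-+ : ∀ i j → fromℤ (i ℤ.+ j) ≡ fromℤ i + fromℤ j
fromℤ-homo-+ i j = ℚP.toℚᵘ-injective (ℚᵘP.≃-trans (toℚᵘ-/ (i ℤ.+ j) 0)
  (ℚᵘP.≃-trans (ℚᵘ.*≡* (cross-multiplied i j))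
  (ℚᵘP.≃-sym (ℚᵘP.≃-trans (ℚP.toℚᵘ-homo-+ (fromℤ i) (fromℤ j))
                           (ℚᵘP.+-cong (toℚᵘ-/ i 0) (toℚᵘ-/ j 0))))))
  where
  cross-multiplied : ∀ i j → (i ℤ.+ j) ℤ.* + 1 ≡ (i ℤ.* + 1 ℤ.+ j ℤ.* + 1) ℤ.* + 1
  cross-multiplied = solve-∀

fromℤ-homo-* : ∀ i j → fromℤ (i ℤ.* j) ≡ fromℤ i * fromℤ j
fromℤ-homo-* i j = ℚP.toℚᵘ-injective (ℚᵘP.≃-trans (toℚᵘ-/ (i ℤ.* j) 0)
  (ℚᵘP.≃-sym (ℚᵘP.≃-trans (ℚP.toℚᵘ-homo-* (fromℤ i) (fromℤ j))
                           (ℚᵘP.*-cong (toℚᵘ-/ i 0) (toℚᵘ-/ j 0)))))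

fromℤ-homo-neg : ∀ i → fromℤ (ℤ.- i) ≡ - fromℤ i
fromℤ-homo-neg i = ℚP.toℚᵘ-injective (ℚᵘP.≃-trans (toℚᵘ-/ (ℤ.- i) 0)
  (ℚᵘP.≃-sym (ℚᵘP.≃-trans (ℚP.toℚᵘ-homo‿- (fromℤ i)) (ℚᵘP.-‿cong (toℚᵘ-/ i 0)))))

fromℤ-mono-≤ : ∀ {i j} → i ℤ.≤ j → fromℤ i ≤ fromℤ j
fromℤ-mono-≤ {i} {j} i≤j = ℚP.toℚᵘ-cancel-≤
  (ℚᵘP.≤-respˡ-≃ (ℚᵘP.≃-sym (toℚᵘ-/ i 0)) (ℚᵘP.≤-respʳ-≃ (ℚᵘP.≃-sym (toℚᵘ-/ j 0))
    (ℚᵘ.*≤* (ℤP.*-monoʳ-≤-nonNeg (+ 1) i≤j))))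

fromℤ-cancel-≤ : ∀ {i j} → fromℤ i ≤ fromℤ j → i ℤ.≤ j
fromℤ-cancel-≤ {i} {j} le
  with ℚᵘP.≤-respˡ-≃ (toℚᵘ-/ i 0) (ℚᵘP.≤-respʳ-≃ (toℚᵘ-/ j 0) (ℚP.toℚᵘ-mono-≤ le))
... | ℚᵘ.*≤* i*1≤j*1 = ℤP.*-cancelʳ-≤-pos i j (+ 1) i*1≤j*1

fromℤ-cancel-< : ∀ {i j} → fromℤ i < fromℤ j → i ℤ.< j
fromℤ-cancel-< {i} {j} lt
  with ℚᵘP.<-respˡ-≃ (toℚᵘ-/ i 0) (ℚᵘP.<-respʳ-≃ (toℚᵘ-/ j 0) (ℚP.toℚᵘ-mono-< lt))
... | ℚᵘ.*<* i*1<j*1 = ℤP.*-cancelʳ-<-nonNeg (+ 1) i*1<j*1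

/-*-denominator : ∀ i n .{{_ : ℕ.NonZero n}} → (i / n) * fromℤ (+ n) ≡ fromℤ i
/-*-denominator i n@(suc m) = ℚP.toℚᵘ-injective
  (ℚᵘP.≃-trans (ℚP.toℚᵘ-homo-* (i / n) (fromℤ (+ n)))
  (ℚᵘP.≃-trans (ℚᵘP.*-cong (toℚᵘ-/ i m) (toℚᵘ-/ (+ n) 0))
  (ℚᵘP.≃-trans (ℚᵘ.*≡* cross-multiplied) (ℚᵘP.≃-sym (toℚᵘ-/ i 0)))))
  where
  cross-multiplied : (i ℤ.* + n) ℤ.* + 1 ≡ i ℤ.* + (n ℕ.* 1)
  cross-multiplied = trans (ℤP.*-identityʳ _) (cong (λ k → i ℤ.* + k) (sym (ℕP.*-identityʳ n)))

fromℤ-floor-≤ : ∀ x → fromℤ (floor x) ≤ x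
fromℤ-floor-≤ x@(mkℚ n d-1 _) = ℚP.toℚᵘ-cancel-≤ (ℚᵘP.≤-respˡ-≃ (ℚᵘP.≃-sym (toℚᵘ-/ (floor x) 0))
  (ℚᵘ.*≤* (subst (floor x ℤ.* + suc d-1 ℤ.≤_) (sym (ℤP.*-identityʳ n)) (ℤD.[n/d]*d≤n n (+ suc d-1)))))

<-fromℤ-floor+1 : ∀ x → x < fromℤ (floor x ℤ.+ + 1)
<-fromℤ-floor+1 x@(mkℚ n d-1 _) = ℚP.toℚᵘ-cancel-<
  (ℚᵘP.<-respʳ-≃ (ℚᵘP.≃-sym (toℚᵘ-/ (floor x ℤ.+ + 1) 0)) (ℚᵘ.*<* n*1<[⌊x⌋+1]*d))
  where
  d : ℤ
  d = + suc d-1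
  open ℤP.≤-Reasoning
  n*1<[⌊x⌋+1]*d : n ℤ.* + 1 ℤ.< (floor x ℤ.+ + 1) ℤ.* d
  n*1<[⌊x⌋+1]*d = begin-strict
    n ℤ.* + 1                     ≡⟨ ℤP.*-identityʳ n ⟩
    n                             ≡⟨ ℤD.a≡a%n+[a/n]*n n d ⟩
    + (n ℤD.% d) ℤ.+ floor x ℤ.* d <⟨ ℤP.+-monoˡ-< (floor x ℤ.* d) (ℤ.+<+ (ℤD.n%d<d n d)) ⟩
    d ℤ.+ floor x ℤ.* d           ≡⟨ distrib (floor x) d ⟩
    (floor x ℤ.+ + 1) ℤ.* d       ∎
    where
    distrib : ∀ f d → d ℤ.+ f ℤ.* d ≡ (f ℤ.+ + 1) ℤ.* d
    distrib = solve-∀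

fromℤ-floor+1≤+1 : ∀ t → fromℤ (floor t ℤ.+ + 1) ≤ t + 1ℚ
fromℤ-floor+1≤+1 t = subst (_≤ t + 1ℚ) (sym (fromℤ-homo-+ (floor t) (+ 1)))
  (ℚP.+-monoˡ-≤ 1ℚ (fromℤ-floor-≤ t))

<-fromℤ⇒floor+1≤ : ∀ x m → x < fromℤ m → floor x ℤ.+ + 1 ℤ.≤ m
<-fromℤ⇒floor+1≤ x m x<m = subst (ℤ._≤ m) (ℤP.+-comm (+ 1) (floor x))
  (ℤP.i<j⇒suc[i]≤j (fromℤ-cancel-< {floor x} (ℚP.≤-<-trans (fromℤ-floor-≤ x) x<m)))

≤-fromℤ-ceiling : ∀ x → x ≤ fromℤ (ceiling x)
≤-fromℤ-ceiling x@record{} = subst₂ _≤_ (neg-involutive x) (sym (fromℤ-homo-neg (floor (- x))))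
  (ℚP.neg-antimono-≤ (fromℤ-floor-≤ (- x)))

floor≤ceiling : ∀ x → floor x ℤ.≤ ceiling x
floor≤ceiling x = fromℤ-cancel-≤ (ℚP.≤-trans (fromℤ-floor-≤ x) (≤-fromℤ-ceiling x))

𝟙Γ≤ : ∀ {G} → ℚ → Conf G → ℕ
𝟙Γ≤ t y = if does (inΓ≤? t y) then 1 else 0

𝟙Γ≤-in : ∀ {G t} {y : Conf G} → InΓ≤ t y → 𝟙Γ≤ t y ≡ 1
𝟙Γ≤-in {t = t} {y} y∈Γ rewrite dec-true (inΓ≤? t y) y∈Γ = refl

𝟙Γ≤-out : ∀ {G t} {y : Conf G} → ¬ InΓ≤ t y → 𝟙Γ≤ t y ≡ 0
𝟙Γ≤-out {t = t} {y} y∉Γ rewrite dec-false (inΓ≤? t y) y∉Γ = refl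

⊥-edge-weight-bound : ∀ t → floor t ℤ.+ + 1 ℤ.≤ ceil+1 t ℤ.+ + 0 ℤ.* (floor t ℤ.+ + 1)
⊥-edge-weight-bound t rewrite ℤP.*-zeroˡ (floor t ℤ.+ + 1) | ℤP.+-identityʳ (ceil+1 t) =
  ℤP.+-monoˡ-≤ (+ 1) (floor≤ceiling t)

edge-weight-bound : ∀ {G t x w y} → Edge' G t x w y →
  floor t ℤ.+ + 1 ℤ.≤ w ℤ.+ + 𝟙Γ≤ t y ℤ.* (floor t ℤ.+ + 1)
edge-weight-bound {G} {t} (step {s' = s'} {c' = c'} _ _) with inΓ≤? t (cfg {G} s' c')
... | yes c'≤t rewrite 𝟙Γ≤-in {t = t} {cfg {G} s' c'} c'≤t
                    | ℤP.*-identityˡ (floor t ℤ.+ + 1) = ℤP.i≤j+i _ (+ c')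
... | no c'≰t rewrite 𝟙Γ≤-out {t = t} {cfg {G} s' c'} c'≰t | ℤP.+-identityʳ (+ c') =
  <-fromℤ⇒floor+1≤ t (+ c') (ℚP.≰⇒> c'≰t)
edge-weight-bound {t = t} (fall _ _) = ⊥-edge-weight-bound t
edge-weight-bound {t = t} loop       = ⊥-edge-weight-bound t

prefix-weight-bound : ∀ {G t} (π : Play G t) n →
  + n ℤ.* (floor t ℤ.+ + 1) ℤ.≤ weightSum π n ℤ.+ + countΓ≤ t π n ℤ.* (floor t ℤ.+ + 1)
prefix-weight-bound π zero = ℤ.+≤+ ℕ.z≤n
prefix-weight-bound {t = t} π (suc n) = subst₂ ℤ._≤_
  (regroupˡ (+ n) D) (regroupʳ (weightSum π n) (+ countΓ≤ t π n) (wt π n) (+ 𝟙Γ≤ t (conf π (suc n))) D)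
  (ℤP.+-mono-≤ (prefix-weight-bound π n) (edge-weight-bound (valid π n)))
  where
  D : ℤ
  D = floor t ℤ.+ + 1
  regroupˡ : ∀ n D → n ℤ.* D ℤ.+ D ≡ (+ 1 ℤ.+ n) ℤ.* D
  regroupˡ = solve-∀
  regroupʳ : ∀ W k w b D → (W ℤ.+ k ℤ.* D) ℤ.+ (w ℤ.+ b ℤ.* D) ≡ (W ℤ.+ w) ℤ.+ (k ℤ.+ b) ℤ.* D
  regroupʳ = solve-∀

gap-≤-visits : ∀ {n K w t D} .{{_ : ℚ.NonNegative K}} →
  n * D ≤ w + K * D → w ≤ n * (t + (D - t) * ½) → D ≤ t + 1ℚ →
  n * (D - t) ≤ K * twoTPlus1 t
gap-≤-visits {n} {K} {w} {t} {D} nD≤w+KD w≤n[t+ε] D≤t+1 = begin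
  n * (D - t)                   ≡⟨ halves n D t ⟩
  n * ε + n * ε                 ≤⟨ ℚP.+-mono-≤ nε≤K[t+1] nε≤K[t+1] ⟩
  K * (t + 1ℚ) + K * (t + 1ℚ)   ≡⟨ doubling K t ⟩
  K * twoTPlus1 t               ∎
  where
  open ℚP.≤-Reasoning
  open +-*-Solver
  ε : ℚ
  ε = (D - t) * ½
  halves : ∀ n D t → n * (D - t) ≡ n * ((D - t) * ½) + n * ((D - t) * ½)
  halves = solve 3 (λ n D t → n :* (D :- t) := n :* ((D :- t) :* con ½) :+ n :* ((D :- t) :* con ½)) refl
  doubling : ∀ K t → K * (t + 1ℚ) + K * (t + 1ℚ) ≡ K * twoTPlus1 t
  doubling = solve 2 (λ K t → K :* (t :+ con 1ℚ) :+ K :* (t :+ con 1ℚ) := K :* (con (+ 2 / 1) :* (t :+ con 1ℚ))) refl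
  nD-gap : ∀ n D t → n * ((D - t) * ½) ≡ n * D - n * (t + (D - t) * ½)
  nD-gap = solve 3 (λ n D t → n :* ((D :- t) :* con ½) := n :* D :- n :* (t :+ (D :- t) :* con ½)) refl
  add-sub : ∀ a b → a + b - a ≡ b
  add-sub = solve 2 (λ a b → a :+ b :- a := b) refl
  nε≤KD : n * ε ≤ K * D
  nε≤KD = begin
    n * ε                              ≡⟨ nD-gap n D t ⟩
    n * D - n * (t + ε)                ≤⟨ ℚP.+-monoˡ-≤ (- (n * (t + ε)))
                                            (ℚP.≤-trans nD≤w+KD (ℚP.+-monoˡ-≤ (K * D) w≤n[t+ε])) ⟩
    n * (t + ε) + K * D - n * (t + ε)  ≡⟨ add-sub (n * (t + ε)) (K * D) ⟩
    K * D                              ∎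
  nε≤K[t+1] : n * ε ≤ K * (t + 1ℚ)
  nε≤K[t+1] = ℚP.≤-trans nε≤KD (ℚP.*-monoˡ-≤-nonNeg K D≤t+1)

p≤r*q⇒p÷q≤r : ∀ {p r} q .{{_ : ℚ.Positive q}} →
  p ≤ r * q → ℚ._÷_ p q {{ℚP.pos⇒nonZero q}} ≤ r
p≤r*q⇒p÷q≤r {p} {r} q p≤rq = begin
  p * q⁻¹       ≤⟨ ℚP.*-monoʳ-≤-nonNeg q⁻¹ {{ℚP.pos⇒nonNeg q⁻¹ {{ℚP.1/pos⇒pos q}}}} p≤rq ⟩
  r * q * q⁻¹   ≡⟨ ℚP.*-assoc r q q⁻¹ ⟩
  r * (q * q⁻¹) ≡⟨ cong (r *_) (ℚP.*-inverseʳ q {{ℚP.pos⇒nonZero q}}) ⟩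
  r * 1ℚ        ≡⟨ ℚP.*-identityʳ r ⟩
  r             ∎
  where
  open ℚP.≤-Reasoning
  q⁻¹ : ℚ
  q⁻¹ = ℚ.1/_ q {{ℚP.pos⇒nonZero q}}

tTilde-pos : ∀ t → ℚ.Positive (tTilde t)
tTilde-pos t = ℚ.positive (subst (_< tTilde t) (ℚP.+-inverseʳ t)
  (ℚP.+-monoˡ-< (- t) (<-fromℤ-floor+1 t)))

/≤⇒≤* : ∀ {i r} n .{{_ : ℕ.NonZero n}} → i / n ≤ r → fromℤ i ≤ fromℤ (+ n) * r
/≤⇒≤* {i} {r} n i/n≤r = subst₂ _≤_ (/-*-denominator i n) (ℚP.*-comm r (fromℤ (+ n)))
  (ℚP.*-monoʳ-≤-nonNeg (fromℤ (+ n)) {{ℚP.normalize-nonNeg n 1}} i/n≤r)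

density-bound : ∀ {G t} .{{_ : ℚ.NonNegative t}} (π : Play G t) n .{{_ : ℕ.NonZero n}} →
  average π n ≤ t + tTilde t * ½ →
  ℚ._÷_ (tTilde t) (twoTPlus1 t) {{twoTPlus1-nonZero t}} ≤ densityΓ≤ t π n
density-bound {t = t} π n avg≤ = p≤r*q⇒p÷q≤r {tTilde t} {K / n} X {{X-pos}}
  (ℚP.*-cancelˡ-≤-pos n′ {{ℚP.normalize-pos n 1}} (subst (n′ * tTilde t ≤_) (sym n[K/n*X]≡KX)
    (gap-≤-visits {n′} {fromℤ K} {w} {t} {fromℤ D} {{ℚP.normalize-nonNeg (countΓ≤ t π n) 1}}
      nD≤w+KD (/≤⇒≤* {weightSum π n} n avg≤) (fromℤ-floor+1≤+1 t))))
  where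
  X : ℚ
  X = twoTPlus1 t
  D : ℤ
  D = floor t ℤ.+ + 1
  n′ : ℚ
  n′ = fromℤ (+ n)
  K : ℤ
  K = + countΓ≤ t π n
  w : ℚ
  w = fromℤ (weightSum π n)
  X-pos : ℚ.Positive X
  X-pos = ℚP.pos*pos⇒pos (+ 2 / 1) (t + 1ℚ) {{ℚP.nonNeg+pos⇒pos t 1ℚ}}
  nD≤w+KD : n′ * fromℤ D ≤ w + fromℤ K * fromℤ D
  nD≤w+KD = subst₂ _≤_ (fromℤ-homo-* (+ n) D)
    (trans (fromℤ-homo-+ (weightSum π n) (K ℤ.* D)) (cong (w ℚ.+_) (fromℤ-homo-* K D)))
    (fromℤ-mono-≤ (prefix-weight-bound π n))
  n[K/n*X]≡KX : n′ * (K / n * X) ≡ fromℤ K * X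
  n[K/n*X]≡KX = trans (sym (ℚP.*-assoc n′ (K / n) X))
    (cong (_* X) (trans (ℚP.*-comm n′ (K / n)) (/-*-denominator K n)))

-- The initial configuration is irrelevant: the density only counts ρ̂ᵢ for i ≥ 1.
lemma3 : (G : Game) (sinit : Fin (size G)) (t₁ t₂ : ℕ) .{{_ : ℕ.NonZero t₂}}
    (π : Play G (threshold t₁ t₂)) →
    conf π 0 ≡ cfg sinit 0 →
    MPsup≤ π (threshold t₁ t₂) →
    ∃[ n ] ∀ (n' : ℕ) .{{_ : ℕ.NonZero n'}} → n ℕ.≤ n' →
    densityBound t₁ t₂ ℚ.≤ densityΓ≤ (threshold t₁ t₂) π n'
lemma3 G sinit t₁ t₂ π _ mp≤t =
  let N , avg≤ = mp≤t (tTilde t * ½) {{ℚP.pos*pos⇒pos (tTilde t) {{tTilde-pos t}} ½}}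
  in N , λ n N≤n → density-bound {{ℚP.normalize-nonNeg t₁ t₂}} π n (avg≤ n N≤n)
  where
  t : ℚ
  t = threshold t₁ t₂
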